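{- Let $G$ be a labeled $12$-representable (finite, connected) square grid graph having an end-square $S$ whose vertices, in cyclic order around the $4$-cycle, are labeled $1,3,2,x$ (so $3$ is adjacent to $1$ and $2$), such that neither the node labeled $1$ nor the node labeled $3$ belongs to a square other than $S$. Then $G$ has a $12$-representant of the form $w=3\,w_1\,1\,w_2\,2\,w_3$, where $w_1,w_2,w_3$ are (possibly empty) words all of whose letters are at least $4$.
   Context: The grid graph is the infinite graph on $\mathbb{Z}^2$ with vertices adjacent iff at Euclidean distance $1$. A square of an induced subgraph $H$ of it is a set of four vertices of $H$ of the form $\{(x,y),(x+1,y),(x,y+1),(x+1,y+1)\}$. A square grid graph is a finite connected induced subgraph of the grid graph in which every vertex and edge lies in some square of it. A square $S$ is an end-square if it has an edge $ab$ such that neither $a$ nor $b$ is a vertex of a square other than $S$. A labeled graph has distinct positive integers as vertices. A word $w$ is a $12$-representant of a labeled graph $G=(V,E)$ if the set of letters of $w$ is $V$ and for all distinct $x,y\in V$: $xy\notin E$ iff some occurrence of $\min(x,y)$ precedes some occurrence of $\max(x,y)$ in $w$; $G$ is $12$-representable if it has a $12$-representant. -}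

module Defs where

open import Data.Nat using (ℕ; _≤_; _⊓_; _⊔_)
open import Data.Integer using (ℤ; +_; _+_)
open import Data.Product using (_×_; _,_; Σ; ∃; ∃-syntax; proj₁; proj₂)
open import Data.Sum using (_⊎_)
open import Data.List using (List; []; _∷_; _++_)
open import Data.List.Membership.Propositional using (_∈_)
open import Data.List.Relation.Unary.All using (All)
open import Relation.Binary.PropositionalEquality using (_≡_; _≢_)
open import Relation.Nullary using (¬_)
open import Function.Bundles using (_⇔_)

Point : Set
Point = ℤ × ℤ

_+ₚ_ : Point → Point → Point
(a , b) +ₚ (c , d) = (a + c , b + d)

e₁ e₂ e₁₂ : Point
e₁  = (+ 1 , + 0)
e₂  = (+ 0 , + 1)
e₁₂ = (+ 1 , + 1)

GridAdj : Point → Point → Set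
GridAdj p q = (q ≡ p +ₚ e₁) ⊎ (p ≡ q +ₚ e₁) ⊎ (q ≡ p +ₚ e₂) ⊎ (p ≡ q +ₚ e₂)

InSquareAt : Point → Point → Set
InSquareAt c p = (p ≡ c) ⊎ (p ≡ c +ₚ e₁) ⊎ (p ≡ c +ₚ e₂) ⊎ (p ≡ c +ₚ e₁₂)

-- A labeled finite induced subgraph of the grid graph: the (finite) list of
-- labels V, and the grid position of each label.  The graph has vertex set V,
-- and two labels are adjacent iff their positions are adjacent in the grid.
record LabeledGridGraph : Set where
  field
    V   : List ℕ
    pos : ℕ → Point

module _ (G : LabeledGridGraph) where
  open LabeledGridGraph G

  IsLabeling : Set
  IsLabeling = (∀ v → v ∈ V → 1 ≤ v)
             × (∀ u v → u ∈ V → v ∈ V → pos u ≡ pos v → u ≡ v)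

  Adj : ℕ → ℕ → Set
  Adj u v = GridAdj (pos u) (pos v)

  data Walk : ℕ → ℕ → Set where
    here  : ∀ {u} → u ∈ V → Walk u u
    there : ∀ {u v w} → u ∈ V → Adj u v → Walk v w → Walk u w

  Connected : Set
  Connected = ∀ u v → u ∈ V → v ∈ V → Walk u v

  SquareAt : Point → Set
  SquareAt c = ∀ p → InSquareAt c p → ∃[ v ] (v ∈ V × pos v ≡ p)

  SquareGrid : Set
  SquareGrid = Connected
             × (∀ v → v ∈ V → ∃[ c ] (SquareAt c × InSquareAt c (pos v)))
             × (∀ u v → u ∈ V → v ∈ V → Adj u v →
                  ∃[ c ] (SquareAt c × InSquareAt c (pos u) × InSquareAt c (pos v)))

  Precedes : ℕ → ℕ → List ℕ → Set
  Precedes a b w = ∃[ u ] ∃[ t ] (w ≡ u ++ (a ∷ t) × b ∈ t)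

  Is12Representant : List ℕ → Set
  Is12Representant w =
      (∀ a → a ∈ w → a ∈ V)
    × (∀ v → v ∈ V → v ∈ w)
    × (∀ x y → x ∈ V → y ∈ V → x ≢ y →
         ((¬ Adj x y) ⇔ Precedes (x ⊓ y) (x ⊔ y) w))

  Is12Representable : Set
  Is12Representable = ∃[ w ] Is12Representant w

module Submission where

-- Take any 12-representant w of G and cut it at the first occurrence of 1 or 2.
-- In either case the letters ≥ 4 of w, kept in their order, split into three
-- consecutive blocks A B C such that the non-neighbours ≥ 4 of 1 are exactly the
-- letters of B C and the non-neighbours ≥ 4 of 2 are exactly those of C.  The word
-- 3 A 1 B 2 C is again a 12-representant: two letters ≥ 4 keep their relative
-- order, because deleting the letters 1, 2, 3 preserves and reflects precedence,
-- and the pairs involving 1, 2 or 3 are settled by the local structure of G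
-- around the end-square: 1 ~ 3 ~ 2, 1 ≁ 2, the neighbours of 3 are 1 and 2, and
-- every neighbour ≥ 4 of 1 (namely x) is a neighbour of 2.

open import Defs
open import Level using (Level)
open import Data.Bool using (Bool; true; false; not; _xor_)
open import Data.Bool.Properties using (not-¬; not-involutive; not-distribˡ-xor; not-distribʳ-xor)
open import Data.Nat using (ℕ; suc; _≤_; _<_; _⊓_; _⊔_; z≤n; s≤s; _≤?_; _≟_)
open import Data.Nat.Properties using (<-cmp; <⇒≤; <⇒≢; <⇒≱; <-irrefl; <-≤-trans; ≤-trans; m≤n⇒m⊓n≡m; m≤n⇒m⊔n≡n; m≥n⇒m⊓n≡n; m≥n⇒m⊔n≡m)
open import Data.Integer using (ℤ; +_; _+_)
open import Data.Integer.Properties using (+-assoc; +-identityʳ; +-0-abelianGroup)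
open import Algebra.Properties.AbelianGroup +-0-abelianGroup using (∙-cancelˡ)
open import Data.Product using (_×_; _,_; ∃-syntax; proj₁; proj₂)
open import Data.Sum using (_⊎_; inj₁; inj₂)
open import Data.Empty using (⊥-elim)
open import Data.List using (List; []; _∷_; _++_; filter)
open import Data.List.Properties using (++-assoc; filter-++; filter-reject; filter-all)
open import Data.List.Membership.Propositional using (_∈_; _∉_)
open import Data.List.Membership.Propositional.Properties using (∈-filter⁺; ∈-filter⁻; ∈-++⁺ˡ; ∈-++⁺ʳ; ∈-++⁻)
open import Data.List.Relation.Unary.All as All using (All; []; _∷_)
open import Data.List.Relation.Unary.All.Properties using (all-filter; filter⁺; ++⁺; ++⁻; All¬⇒¬Any; ¬Any⇒All¬)
open import Data.List.Relation.Unary.Any as Any using (Any; here; there)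
import Data.List.Relation.Unary.First as First
open First using (FirstView)
open import Relation.Binary.PropositionalEquality using (_≡_; _≢_; refl; sym; trans; cong; cong₂; subst; subst₂)
open import Relation.Binary.Definitions using (tri<; tri≈; tri>)
open import Relation.Nullary using (¬_; yes; no; contradiction)
open import Relation.Nullary.Decidable using (_⊎-dec_)
open import Relation.Unary using (Pred; Decidable; ∁)
open import Function using (_∘_)
open import Function.Bundles using (_⇔_; mk⇔; Equivalence)
open import Function.Properties.Equivalence using () renaming (sym to ⇔-sym)
open import Function.Related.Propositional using (module EquationalReasoning; equivalence)
open EquationalReasoning {k = equivalence}

Corner : Set
Corner = Bool × Bool

bit : Bool → ℤ
bit false = + 0
bit true  = + 1

corner : Corner → Point
corner (i , j) = (bit i , bit j)

Neighbour : Corner → Corner → Set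
Neighbour (i , j) k = k ≡ (not i , j) ⊎ k ≡ (i , not j)

colour : Corner → Bool
colour (i , j) = i xor j

neighbour-colour : ∀ {k k′} → Neighbour k k′ → colour k′ ≡ not (colour k)
neighbour-colour {i , j} (inj₁ refl) = sym (not-distribˡ-xor i j)
neighbour-colour {i , j} (inj₂ refl) = sym (not-distribʳ-xor i j)

no-triangle : ∀ {a b c} → Neighbour a b → Neighbour b c → ¬ Neighbour a c
no-triangle {a} ab bc ac = not-¬ c≡a (neighbour-colour ac)
  where
  c≡a = trans (neighbour-colour bc) (trans (cong not (neighbour-colour ab)) (not-involutive (colour a)))

two-neighbours : ∀ {k a b v} → Neighbour k a → Neighbour k b → a ≢ b → Neighbour k v → v ≡ a ⊎ v ≡ b
two-neighbours {i , j} (inj₁ refl) (inj₁ refl) a≢b _ = ⊥-elim (a≢b refl)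
two-neighbours {i , j} (inj₂ refl) (inj₂ refl) a≢b _ = ⊥-elim (a≢b refl)
two-neighbours {i , j} (inj₁ refl) (inj₂ refl) _ (inj₁ refl) = inj₁ refl
two-neighbours {i , j} (inj₁ refl) (inj₂ refl) _ (inj₂ refl) = inj₂ refl
two-neighbours {i , j} (inj₂ refl) (inj₁ refl) _ (inj₁ refl) = inj₂ refl
two-neighbours {i , j} (inj₂ refl) (inj₁ refl) _ (inj₂ refl) = inj₁ refl

bit-step : ∀ {x y} → bit x ≡ bit y + + 1 → x ≡ true × y ≡ false
bit-step {true}  {false} _ = refl , refl
bit-step {false} {false} ()
bit-step {false} {true}  ()
bit-step {true}  {true}  ()

bit-still : ∀ {x y} → bit x ≡ bit y + + 0 → x ≡ y
bit-still {false} {false} _ = refl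
bit-still {true}  {true}  _ = refl
bit-still {false} {true}  ()
bit-still {true}  {false} ()

cancel-offset : ∀ a {x y} d → a + x ≡ (a + y) + d → x ≡ y + d
cancel-offset a {x} {y} d eq = ∙-cancelˡ a x (y + d) (trans eq (+-assoc a y d))

gridAdj⇒neighbour : ∀ {c k k′} → GridAdj (c +ₚ corner k) (c +ₚ corner k′) → Neighbour k k′
gridAdj⇒neighbour {a , b} {i , j} {i′ , j′} (inj₁ e)
  with bit-step {i′} {i} (cancel-offset a (+ 1) (cong proj₁ e))
     | bit-still {j′} {j} (cancel-offset b (+ 0) (cong proj₂ e))
... | refl , refl | refl = inj₁ refl
gridAdj⇒neighbour {a , b} {i , j} {i′ , j′} (inj₂ (inj₁ e))
  with bit-step {i} {i′} (cancel-offset a (+ 1) (cong proj₁ e))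
     | bit-still {j} {j′} (cancel-offset b (+ 0) (cong proj₂ e))
... | refl , refl | refl = inj₁ refl
gridAdj⇒neighbour {a , b} {i , j} {i′ , j′} (inj₂ (inj₂ (inj₁ e)))
  with bit-still {i′} {i} (cancel-offset a (+ 0) (cong proj₁ e))
     | bit-step {j′} {j} (cancel-offset b (+ 1) (cong proj₂ e))
... | refl | refl , refl = inj₂ refl
gridAdj⇒neighbour {a , b} {i , j} {i′ , j′} (inj₂ (inj₂ (inj₂ e)))
  with bit-still {i} {i′} (cancel-offset a (+ 0) (cong proj₁ e))
     | bit-step {j} {j′} (cancel-offset b (+ 1) (cong proj₂ e))
... | refl | refl , refl = inj₂ refl

inSquare⇒corner : ∀ {c p} → InSquareAt c p → ∃[ k ] (p ≡ c +ₚ corner k)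
inSquare⇒corner {a , b} (inj₁ e) = (false , false) , trans e (sym (cong₂ _,_ (+-identityʳ a) (+-identityʳ b)))
inSquare⇒corner (inj₂ (inj₁ e)) = (true , false) , e
inSquare⇒corner (inj₂ (inj₂ (inj₁ e))) = (false , true) , e
inSquare⇒corner (inj₂ (inj₂ (inj₂ e))) = (true , true) , e

private variable
  ℓ : Level
  a b v y : ℕ
  xs ys t w : List ℕ

-- Prec a b w: some occurrence of a in w is followed by an occurrence of b
-- (an inductive form of `Precedes`, convenient for induction on w).
data Prec (a b : ℕ) : List ℕ → Set where
  start : b ∈ t → Prec a b (a ∷ t)
  skip  : Prec a b t → Prec a b (y ∷ t)

prec-∈ : Prec a b t → b ∈ t
prec-∈ (start m) = there m
prec-∈ (skip p)  = there (prec-∈ p)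

prec-++ : ∀ xs → b ∈ t → Prec a b (xs ++ a ∷ t)
prec-++ []       m = start m
prec-++ (_ ∷ xs) m = skip (prec-++ xs m)

prec-drop : ∀ xs → a ∉ xs → Prec a b (xs ++ t) → Prec a b t
prec-drop []       _   p         = p
prec-drop (_ ∷ xs) a∉ (start _)  = ⊥-elim (a∉ (here refl))
prec-drop (_ ∷ xs) a∉ (skip p)   = prec-drop xs (λ m → a∉ (there m)) p

prec-first : ∀ xs → a ∉ xs → Prec a b (xs ++ a ∷ t) ⇔ b ∈ t
prec-first xs a∉ = mk⇔ (λ p → after-head (prec-drop xs a∉ p)) (prec-++ xs)
  where
  after-head : Prec a b (a ∷ t) → b ∈ t
  after-head (start m) = m
  after-head (skip p)  = prec-∈ p

module _ {P : Pred ℕ ℓ} (P? : Decidable P) (Pa : P a) (Pb : P b) where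

  prec-filter⁺ : Prec a b w → Prec a b (filter P? w)
  prec-filter⁺ {w = _ ∷ t} (start m) with P? a
  ... | yes _  = start (∈-filter⁺ P? m Pb)
  ... | no ¬Pa = ⊥-elim (¬Pa Pa)
  prec-filter⁺ {w = y ∷ t} (skip p) with P? y
  ... | yes _ = skip (prec-filter⁺ p)
  ... | no _  = prec-filter⁺ p

  prec-filter⁻ : ∀ w → Prec a b (filter P? w) → Prec a b w
  prec-filter⁻ (y ∷ t) p with P? y | p
  ... | yes _ | start m = start (proj₁ (∈-filter⁻ P? {xs = t} m))
  ... | yes _ | skip q  = skip (prec-filter⁻ t q)
  ... | no _  | q       = skip (prec-filter⁻ t q)

  prec-filter : ∀ w → Prec a b (filter P? w) ⇔ Prec a b w
  prec-filter w = mk⇔ (prec-filter⁻ w) prec-filter⁺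

∈-filter : {P : Pred ℕ ℓ} (P? : Decidable P) → P v → v ∈ filter P? xs ⇔ v ∈ xs
∈-filter P? Pv = mk⇔ (λ m → proj₁ (∈-filter⁻ P? m)) (λ m → ∈-filter⁺ P? m Pv)

∈-insert : ∀ xs → v ∈ xs ++ ys → v ∈ xs ++ y ∷ ys
∈-insert xs m with ∈-++⁻ xs m
... | inj₁ m₁ = ∈-++⁺ˡ m₁
... | inj₂ m₂ = ∈-++⁺ʳ xs (there m₂)

∈-skip : ∀ xs → v ≢ y → v ∈ xs ++ y ∷ ys ⇔ v ∈ xs ++ ys
∈-skip xs v≢y = mk⇔ to (∈-insert xs)
  where
  to : _ ∈ xs ++ _ ∷ _ → _ ∈ xs ++ _
  to m with ∈-++⁻ xs m
  ... | inj₁ m₁         = ∈-++⁺ˡ m₁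
  ... | inj₂ (here v≡y) = ⊥-elim (v≢y v≡y)
  ... | inj₂ (there m₂) = ∈-++⁺ʳ xs m₂

firstView : {P : Pred ℕ ℓ} → Decidable P → Any P w → FirstView (∁ P) P w
firstView {w = y ∷ t} P? any with P? y
... | yes Py = [] First.++ Py ∷ t
firstView P? (here Py)   | no ¬Py = ⊥-elim (¬Py Py)
firstView P? (there any) | no ¬Py with firstView P? any
... | ¬Ps First.++ Pz ∷ zs = (¬Py ∷ ¬Ps) First.++ Pz ∷ zs

gridAdj-sym : ∀ {p q} → GridAdj p q → GridAdj q p
gridAdj-sym (inj₁ e)                = inj₂ (inj₁ e)
gridAdj-sym (inj₂ (inj₁ e))         = inj₁ e
gridAdj-sym (inj₂ (inj₂ (inj₁ e)))  = inj₂ (inj₂ (inj₂ e))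
gridAdj-sym (inj₂ (inj₂ (inj₂ e)))  = inj₂ (inj₂ (inj₁ e))

module Representation (G : LabeledGridGraph) where
  open LabeledGridGraph G

  precedes⇔prec : ∀ {a b w} → Precedes G a b w ⇔ Prec a b w
  precedes⇔prec = mk⇔ from-precedes to-precedes
    where
    from-precedes : ∀ {a b w} → Precedes G a b w → Prec a b w
    from-precedes (u , _ , refl , m) = prec-++ u m
    to-precedes : ∀ {a b w} → Prec a b w → Precedes G a b w
    to-precedes (start m) = [] , _ , refl , m
    to-precedes (skip {y = y} p) with to-precedes p
    ... | u , t , refl , m = y ∷ u , t , refl , m

  Unordered12 : List ℕ → Set
  Unordered12 w = ∀ x y → x ∈ V → y ∈ V → x ≢ y → ((¬ Adj G x y) ⇔ Precedes G (x ⊓ y) (x ⊔ y) w)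

  Ordered12 : List ℕ → Set
  Ordered12 w = ∀ a b → a ∈ V → b ∈ V → a < b → ((¬ Adj G a b) ⇔ Prec a b w)

  unordered⇒ordered : ∀ {w} → Unordered12 w → Ordered12 w
  unordered⇒ordered {w} cond a b a∈ b∈ a<b = begin
    ¬ Adj G a b                   ∼⟨ cond a b a∈ b∈ (<⇒≢ a<b) ⟩
    Precedes G (a ⊓ b) (a ⊔ b) w  ≡⟨ cong₂ (λ p q → Precedes G p q w) (m≤n⇒m⊓n≡m (<⇒≤ a<b)) (m≤n⇒m⊔n≡n (<⇒≤ a<b)) ⟩
    Precedes G a b w              ∼⟨ precedes⇔prec ⟩
    Prec a b w                    ∎

  ordered⇒unordered : ∀ {w} → Ordered12 w → Unordered12 w
  ordered⇒unordered {w} ord x y x∈ y∈ x≢y with <-cmp x y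
  ... | tri≈ _ x≡y _ = ⊥-elim (x≢y x≡y)
  ... | tri< x<y _ _ = begin
    ¬ Adj G x y                   ∼⟨ ord x y x∈ y∈ x<y ⟩
    Prec x y w                    ∼⟨ ⇔-sym precedes⇔prec ⟩
    Precedes G x y w              ≡⟨ sym (cong₂ (λ p q → Precedes G p q w) (m≤n⇒m⊓n≡m (<⇒≤ x<y)) (m≤n⇒m⊔n≡n (<⇒≤ x<y))) ⟩
    Precedes G (x ⊓ y) (x ⊔ y) w  ∎
  ... | tri> _ _ y<x = begin
    ¬ Adj G x y                   ∼⟨ mk⇔ (λ n a → n (gridAdj-sym a)) (λ n a → n (gridAdj-sym a)) ⟩
    ¬ Adj G y x                   ∼⟨ ord y x y∈ x∈ y<x ⟩
    Prec y x w                    ∼⟨ ⇔-sym precedes⇔prec ⟩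
    Precedes G y x w              ≡⟨ sym (cong₂ (λ p q → Precedes G p q w) (m≥n⇒m⊓n≡n (<⇒≤ y<x)) (m≥n⇒m⊔n≡m (<⇒≤ y<x))) ⟩
    Precedes G (x ⊓ y) (x ⊔ y) w  ∎

high : List ℕ → List ℕ
high = filter (4 ≤?_)

high-drop : ∀ xs ys {y} → y < 4 → high (xs ++ y ∷ ys) ≡ high xs ++ high ys
high-drop xs ys {y} y<4 = trans (filter-++ (4 ≤?_) xs (y ∷ ys)) (cong (high xs ++_) (filter-reject (4 ≤?_) (<⇒≱ y<4)))

high≢low : ∀ {v u} → 4 ≤ v → u < 4 → v ≢ u
high≢low v≥4 u<4 refl = <⇒≱ u<4 v≥4

avoids-low : ∀ {u xs} → u < 4 → All (4 ≤_) xs → All (u ≢_) xs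
avoids-low u<4 = All.map (λ h u≡ → high≢low h u<4 (sym u≡))

low∉high : ∀ {u xs} → u < 4 → All (4 ≤_) xs → u ∉ xs
low∉high u<4 hs = All¬⇒¬Any (avoids-low u<4 hs)

1<4 : 1 < 4
1<4 = s≤s (s≤s z≤n)

2<4 : 2 < 4
2<4 = s≤s (s≤s (s≤s z≤n))

3<4 : 3 < 4
3<4 = s≤s (s≤s (s≤s (s≤s z≤n)))

data Kind : ℕ → Set where
  one   : Kind 1
  two   : Kind 2
  three : Kind 3
  high≥4 : ∀ {v} → 4 ≤ v → Kind v

kind : ∀ v → 1 ≤ v → Kind v
kind 1 _ = one
kind 2 _ = two
kind 3 _ = three
kind (suc (suc (suc (suc _)))) _ = high≥4 (s≤s (s≤s (s≤s (s≤s z≤n))))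

module Reorder (G : LabeledGridGraph)
  (positive : ∀ v → v ∈ LabeledGridGraph.V G → 1 ≤ v)
  (1∈V : 1 ∈ LabeledGridGraph.V G) (2∈V : 2 ∈ LabeledGridGraph.V G) (3∈V : 3 ∈ LabeledGridGraph.V G)
  (1~3 : Adj G 1 3) (3~2 : Adj G 3 2) (1≁2 : ¬ Adj G 1 2)
  (N3 : ∀ v → v ∈ LabeledGridGraph.V G → Adj G 3 v → v ≡ 1 ⊎ v ≡ 2)
  (N1-high : ∀ v → v ∈ LabeledGridGraph.V G → 4 ≤ v → Adj G 1 v → Adj G 2 v)
  where
  open LabeledGridGraph G
  open Representation G

  record Split (w : List ℕ) : Set where
    field
      A B C   : List ℕ
      A-high  : All (4 ≤_) A
      B-high  : All (4 ≤_) B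
      C-high  : All (4 ≤_) C
      high-w  : high w ≡ A ++ B ++ C
      after-1 : ∀ v → v ∈ V → 4 ≤ v → ((¬ Adj G 1 v) ⇔ v ∈ B ++ C)
      after-2 : ∀ v → v ∈ V → 4 ≤ v → ((¬ Adj G 2 v) ⇔ v ∈ C)

  non-neighbours-after : ∀ {a} xs ys → a ∈ V → a < 4 → a ∉ xs → Ordered12 (xs ++ a ∷ ys) →
    ∀ v → v ∈ V → 4 ≤ v → ((¬ Adj G a v) ⇔ v ∈ high ys)
  non-neighbours-after {a} xs ys a∈ a<4 a∉ ord v v∈ v≥4 = begin
    ¬ Adj G a v            ∼⟨ ord a v a∈ v∈ (<-≤-trans a<4 v≥4) ⟩
    Prec a v (xs ++ a ∷ ys) ∼⟨ prec-first xs a∉ ⟩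
    v ∈ ys                 ∼⟨ ⇔-sym (∈-filter (4 ≤?_) v≥4) ⟩
    v ∈ high ys            ∎

  split-at-1-then-2 : ∀ P Q₁ Q₂ → 1 ∉ P → 2 ∉ P ++ 1 ∷ Q₁ →
    Ordered12 (P ++ 1 ∷ Q₁ ++ 2 ∷ Q₂) → Split (P ++ 1 ∷ Q₁ ++ 2 ∷ Q₂)
  split-at-1-then-2 P Q₁ Q₂ 1∉ 2∉ ord = record
    { A = high P ; B = high Q₁ ; C = high Q₂
    ; A-high = all-filter (4 ≤?_) P ; B-high = all-filter (4 ≤?_) Q₁ ; C-high = all-filter (4 ≤?_) Q₂
    ; high-w = trans (high-drop P (Q₁ ++ 2 ∷ Q₂) 1<4) (cong (high P ++_) (high-drop Q₁ Q₂ 2<4))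
    ; after-1 = λ v v∈ v≥4 → subst (λ zs → (¬ Adj G 1 v) ⇔ v ∈ zs) (high-drop Q₁ Q₂ 2<4)
                  (non-neighbours-after P (Q₁ ++ 2 ∷ Q₂) 1∈V 1<4 1∉ ord v v∈ v≥4)
    ; after-2 = non-neighbours-after (P ++ 1 ∷ Q₁) Q₂ 2∈V 2<4 2∉
                  (subst Ordered12 (sym (++-assoc P (1 ∷ Q₁) (2 ∷ Q₂))) ord)
    }

  -- w = P 2 Q with no 1 before the first 2: every non-neighbour ≥ 4 of 1 comes
  -- after some 1, hence after that 2, so 1 and 2 have the same non-neighbours ≥ 4.
  split-at-2 : ∀ P Q → 1 ∉ P → 2 ∉ P → Ordered12 (P ++ 2 ∷ Q) → Split (P ++ 2 ∷ Q)
  split-at-2 P Q 1∉ 2∉ ord = record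
    { A = high P ; B = [] ; C = high Q
    ; A-high = all-filter (4 ≤?_) P ; B-high = [] ; C-high = all-filter (4 ≤?_) Q
    ; high-w = high-drop P Q 2<4
    ; after-1 = λ v v∈ v≥4 → begin
        ¬ Adj G 1 v  ∼⟨ mk⇔ (1-then-2 v v∈ v≥4) (λ n a → n (N1-high v v∈ v≥4 a)) ⟩
        ¬ Adj G 2 v  ∼⟨ after-2 v v∈ v≥4 ⟩
        v ∈ high Q   ∎
    ; after-2 = after-2
    }
    where
    after-2 : ∀ v → v ∈ V → 4 ≤ v → ((¬ Adj G 2 v) ⇔ v ∈ high Q)
    after-2 = non-neighbours-after P Q 2∈V 2<4 2∉ ord
    1-then-2 : ∀ v → v ∈ V → 4 ≤ v → ¬ Adj G 1 v → ¬ Adj G 2 v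
    1-then-2 v v∈ v≥4 n = Equivalence.from (after-2 v v∈ v≥4)
      (∈-filter⁺ (4 ≤?_) (prec-∈ (prec-drop (2 ∷ []) (λ { (here ()) ; (there ()) })
        (prec-drop P 1∉ (Equivalence.to (ord 1 v 1∈V v∈ (<-≤-trans 1<4 v≥4)) n)))) v≥4)

  -- Since 1 ≁ 2, some 2 follows the first 1.
  2-after-1 : ∀ P Q → 1 ∉ P → Ordered12 (P ++ 1 ∷ Q) → 2 ∈ Q
  2-after-1 P Q 1∉ ord = Equivalence.to (prec-first P 1∉) (Equivalence.to (ord 1 2 1∈V 2∈V (s≤s (s≤s z≤n))) 1≁2)

  split-at-1 : ∀ P Q → 1 ∉ P → 2 ∉ P → Ordered12 (P ++ 1 ∷ Q) → Split (P ++ 1 ∷ Q)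
  split-at-1 P Q 1∉ 2∉ ord with firstView (2 ≟_) (2-after-1 P Q 1∉ ord)
  ... | First._++_∷_ {Q₁} ¬2 refl Q₂ =
    split-at-1-then-2 P Q₁ Q₂ 1∉ (All¬⇒¬Any (++⁺ (¬Any⇒All¬ P 2∉) ((λ ()) ∷ ¬2))) ord

  OneOrTwo : ℕ → Set
  OneOrTwo y = 1 ≡ y ⊎ 2 ≡ y

  ∉P : ∀ {P v} → All (λ y → ¬ OneOrTwo y) P → OneOrTwo v → v ∉ P
  ∉P ¬12 p m = All.lookup ¬12 m p

  split : ∀ w → Ordered12 w → 1 ∈ w → Split w
  split w ord 1∈w with firstView (λ y → (1 ≟ y) ⊎-dec (2 ≟ y)) (Any.map inj₁ 1∈w)
  ... | First._++_∷_ {P} ¬12 (inj₁ refl) Q = split-at-1 P Q (∉P ¬12 (inj₁ refl)) (∉P ¬12 (inj₂ refl)) ord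
  ... | First._++_∷_ {P} ¬12 (inj₂ refl) Q = split-at-2 P Q (∉P ¬12 (inj₁ refl)) (∉P ¬12 (inj₂ refl)) ord

  module Reordered {w} (w⊆V : ∀ a → a ∈ w → a ∈ V) (V⊆w : ∀ v → v ∈ V → v ∈ w)
                       (ord : Ordered12 w) (S : Split w) where
    open Split S

    W : List ℕ
    W = 3 ∷ A ++ 1 ∷ B ++ 2 ∷ C

    high-W : high W ≡ A ++ B ++ C
    high-W = trans (filter-reject (4 ≤?_) {xs = A ++ 1 ∷ B ++ 2 ∷ C} (<⇒≱ 3<4))
      (trans (high-drop A (B ++ 2 ∷ C) 1<4) (cong₂ _++_ (filter-all (4 ≤?_) A-high)
      (trans (high-drop B C 2<4) (cong₂ _++_ (filter-all (4 ≤?_) B-high) (filter-all (4 ≤?_) C-high)))))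

    W⊆V : ∀ a → a ∈ W → a ∈ V
    W⊆V a = All.lookup (3∈V ∷ ++⁺ A⊆V (1∈V ∷ ++⁺ B⊆V (2∈V ∷ C⊆V)))
      where
      ABC⊆V : All (_∈ V) (A ++ B ++ C)
      ABC⊆V = subst (All (_∈ V)) high-w (filter⁺ (4 ≤?_) (All.tabulate (w⊆V _)))
      A⊆V = proj₁ (++⁻ A ABC⊆V)
      B⊆V = proj₁ (++⁻ B (proj₂ (++⁻ A ABC⊆V)))
      C⊆V = proj₂ (++⁻ B (proj₂ (++⁻ A ABC⊆V)))

    high⊆W : ∀ {v} → v ∈ V → 4 ≤ v → v ∈ A ++ 1 ∷ B ++ 2 ∷ C
    high⊆W {v} v∈ v≥4 with ∈-++⁻ A (subst (v ∈_) high-w (∈-filter⁺ (4 ≤?_) (V⊆w v v∈) v≥4))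
    ... | inj₁ ∈A  = ∈-++⁺ˡ ∈A
    ... | inj₂ ∈BC = ∈-++⁺ʳ A (there (∈-insert B ∈BC))

    V⊆W : ∀ v → v ∈ V → v ∈ W
    V⊆W v v∈ with kind v (positive v v∈)
    ... | one      = there (∈-++⁺ʳ A (here refl))
    ... | two      = there (∈-++⁺ʳ A (there (∈-++⁺ʳ B (here refl))))
    ... | three    = here refl
    ... | high≥4 h = there (high⊆W v∈ h)

    prec-1 : ∀ {v} → Prec 1 v W ⇔ v ∈ B ++ 2 ∷ C
    prec-1 = prec-first (3 ∷ A) (All¬⇒¬Any ((λ ()) ∷ avoids-low 1<4 A-high))

    prec-2 : ∀ {v} → Prec 2 v W ⇔ v ∈ C
    prec-2 {v} = begin
      Prec 2 v W                       ≡⟨ cong (λ zs → Prec 2 v (3 ∷ zs)) (sym (++-assoc A (1 ∷ B) (2 ∷ C))) ⟩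
      Prec 2 v ((3 ∷ A ++ 1 ∷ B) ++ 2 ∷ C) ∼⟨ prec-first (3 ∷ A ++ 1 ∷ B) 2∉ ⟩
      v ∈ C                            ∎
      where
      2∉ : 2 ∉ 3 ∷ A ++ 1 ∷ B
      2∉ = All¬⇒¬Any ((λ ()) ∷ ++⁺ (avoids-low 2<4 A-high) ((λ ()) ∷ avoids-low 2<4 B-high))

    prec-3 : ∀ {v} → Prec 3 v W ⇔ v ∈ A ++ 1 ∷ B ++ 2 ∷ C
    prec-3 = prec-first [] (λ ())

    from-1 : ∀ b → b ∈ V → 1 < b → ((¬ Adj G 1 b) ⇔ Prec 1 b W)
    from-1 b b∈ 1<b with kind b (positive b b∈)
    ... | one      = ⊥-elim (<-irrefl refl 1<b)
    ... | two      = mk⇔ (λ _ → Equivalence.from prec-1 (∈-++⁺ʳ B (here refl))) (λ _ → 1≁2)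
    ... | three    = mk⇔ (contradiction 1~3) (λ p → ⊥-elim (3∉ (Equivalence.to prec-1 p)))
      where
      3∉ : 3 ∉ B ++ 2 ∷ C
      3∉ = All¬⇒¬Any (++⁺ (avoids-low 3<4 B-high) ((λ ()) ∷ avoids-low 3<4 C-high))
    ... | high≥4 h = begin
      ¬ Adj G 1 b     ∼⟨ after-1 b b∈ h ⟩
      b ∈ B ++ C      ∼⟨ ⇔-sym (∈-skip B (high≢low h 2<4)) ⟩
      b ∈ B ++ 2 ∷ C  ∼⟨ ⇔-sym prec-1 ⟩
      Prec 1 b W      ∎

    from-2 : ∀ b → b ∈ V → 2 < b → ((¬ Adj G 2 b) ⇔ Prec 2 b W)
    from-2 b b∈ 2<b with kind b (positive b b∈)
    ... | one      = ⊥-elim (<⇒≱ 2<b (s≤s z≤n))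
    ... | two      = ⊥-elim (<-irrefl refl 2<b)
    ... | three    = mk⇔ (contradiction (gridAdj-sym 3~2)) (λ p → ⊥-elim (low∉high 3<4 C-high (Equivalence.to prec-2 p)))
    ... | high≥4 h = begin
      ¬ Adj G 2 b  ∼⟨ after-2 b b∈ h ⟩
      b ∈ C        ∼⟨ ⇔-sym prec-2 ⟩
      Prec 2 b W   ∎

    -- 3 is adjacent only to 1 and 2, and it starts W.
    from-3 : ∀ b → b ∈ V → 4 ≤ b → ((¬ Adj G 3 b) ⇔ Prec 3 b W)
    from-3 b b∈ h = mk⇔ (λ _ → Equivalence.from prec-3 (high⊆W b∈ h)) (λ _ 3~b → not-1-or-2 (N3 b b∈ 3~b))
      where
      not-1-or-2 : ¬ (b ≡ 1 ⊎ b ≡ 2)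
      not-1-or-2 (inj₁ b≡1) = high≢low h 1<4 b≡1
      not-1-or-2 (inj₂ b≡2) = high≢low h 2<4 b≡2

    from-high : ∀ a b → a ∈ V → b ∈ V → a < b → 4 ≤ a → 4 ≤ b → ((¬ Adj G a b) ⇔ Prec a b W)
    from-high a b a∈ b∈ a<b h h′ = begin
      ¬ Adj G a b        ∼⟨ ord a b a∈ b∈ a<b ⟩
      Prec a b w         ∼⟨ ⇔-sym (prec-filter (4 ≤?_) h h′ w) ⟩
      Prec a b (high w)  ≡⟨ cong (Prec a b) (trans high-w (sym high-W)) ⟩
      Prec a b (high W)  ∼⟨ prec-filter (4 ≤?_) h h′ W ⟩
      Prec a b W         ∎

    W-ordered : Ordered12 W
    W-ordered a b a∈ b∈ a<b with kind a (positive a a∈)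
    ... | one      = from-1 b b∈ a<b
    ... | two      = from-2 b b∈ a<b
    ... | three    = from-3 b b∈ a<b
    ... | high≥4 h = from-high a b a∈ b∈ a<b h (≤-trans h (<⇒≤ a<b))

  reorder : ∀ w → Is12Representant G w →
    ∃[ w₁ ] ∃[ w₂ ] ∃[ w₃ ] (All (4 ≤_) w₁ × All (4 ≤_) w₂ × All (4 ≤_) w₃
       × Is12Representant G (3 ∷ w₁ ++ 1 ∷ w₂ ++ 2 ∷ w₃))
  reorder w (w⊆V , V⊆w , cond) =
    A , B , C , A-high , B-high , C-high , W⊆V , V⊆W , ordered⇒unordered W-ordered
    where
    ord = unordered⇒ordered cond
    S = split w ord (V⊆w 1 1∈V)
    open Split S
    open Reordered w⊆V V⊆w ord S

module EndSquare (G : LabeledGridGraph)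
  (injective : ∀ u v → u ∈ LabeledGridGraph.V G → v ∈ LabeledGridGraph.V G →
                 LabeledGridGraph.pos G u ≡ LabeledGridGraph.pos G v → u ≡ v)
  (edge-square : ∀ u v → u ∈ LabeledGridGraph.V G → v ∈ LabeledGridGraph.V G → Adj G u v →
                 ∃[ c′ ] (SquareAt G c′ × InSquareAt c′ (LabeledGridGraph.pos G u) × InSquareAt c′ (LabeledGridGraph.pos G v)))
  (c : Point) where
  open LabeledGridGraph G

  adj⇒neighbour : ∀ {u v k k′} → pos u ≡ c +ₚ corner k → pos v ≡ c +ₚ corner k′ → Adj G u v → Neighbour k k′
  adj⇒neighbour eu ev uv = gridAdj⇒neighbour {c = c} (subst₂ GridAdj eu ev uv)

  same-corner : ∀ {u v k k′} → u ∈ V → v ∈ V → pos u ≡ c +ₚ corner k → pos v ≡ c +ₚ corner k′ → k ≡ k′ → u ≡ v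
  same-corner u∈ v∈ eu ev refl = injective _ _ u∈ v∈ (trans eu (sym ev))

  triangle-free : ∀ {u v t} → InSquareAt c (pos u) → InSquareAt c (pos v) → InSquareAt c (pos t) →
    Adj G u v → Adj G v t → ¬ Adj G u t
  triangle-free su sv st uv vt ut with inSquare⇒corner su | inSquare⇒corner sv | inSquare⇒corner st
  ... | _ , eu | _ , ev | _ , et = no-triangle (adj⇒neighbour eu ev uv) (adj⇒neighbour ev et vt) (adj⇒neighbour eu et ut)

  -- A vertex p lying in no square other than c has only its two neighbours on c,
  -- since every edge at p lies in a square containing p.
  neighbours-of-end-vertex : ∀ {p a b} → p ∈ V → a ∈ V → b ∈ V →
    InSquareAt c (pos p) → InSquareAt c (pos a) → InSquareAt c (pos b) →
    Adj G p a → Adj G p b → a ≢ b →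
    (∀ c′ → SquareAt G c′ → InSquareAt c′ (pos p) → c′ ≡ c) →
    ∀ v → v ∈ V → Adj G p v → v ≡ a ⊎ v ≡ b
  neighbours-of-end-vertex p∈ a∈ b∈ sp sa sb pa pb a≢b only-c v v∈ pv with edge-square _ v p∈ v∈ pv
  ... | c′ , sq′ , sp′ , sv′
    with inSquare⇒corner sp | inSquare⇒corner sa | inSquare⇒corner sb
       | inSquare⇒corner (subst (λ d → InSquareAt d (pos v)) (only-c c′ sq′ sp′) sv′)
  ... | _ , ep | _ , ea | _ , eb | _ , ev
    with two-neighbours (adj⇒neighbour ep ea pa) (adj⇒neighbour ep eb pb)
                        (a≢b ∘ same-corner a∈ b∈ ea eb) (adj⇒neighbour ep ev pv)
  ... | inj₁ kv≡ka = inj₁ (same-corner v∈ a∈ ev ea kv≡ka)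
  ... | inj₂ kv≡kb = inj₂ (same-corner v∈ b∈ ev eb kv≡kb)

corollary12 : (G : LabeledGridGraph) → IsLabeling G → SquareGrid G → Is12Representable G →
    (x : ℕ) → (c : Point) →
    1 ∈ LabeledGridGraph.V G → 2 ∈ LabeledGridGraph.V G → 3 ∈ LabeledGridGraph.V G → x ∈ LabeledGridGraph.V G →
    x ≢ 1 → x ≢ 2 → x ≢ 3 →
    SquareAt G c →
    InSquareAt c (LabeledGridGraph.pos G 1) → InSquareAt c (LabeledGridGraph.pos G 3) →
    InSquareAt c (LabeledGridGraph.pos G 2) → InSquareAt c (LabeledGridGraph.pos G x) →
    Adj G 1 3 → Adj G 3 2 → Adj G 2 x → Adj G x 1 →
    (∀ c′ → SquareAt G c′ → InSquareAt c′ (LabeledGridGraph.pos G 1) → c′ ≡ c) →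
    (∀ c′ → SquareAt G c′ → InSquareAt c′ (LabeledGridGraph.pos G 3) → c′ ≡ c) →
    ∃[ w₁ ] ∃[ w₂ ] ∃[ w₃ ]
      (All (4 ≤_) w₁ × All (4 ≤_) w₂ × All (4 ≤_) w₃
       × Is12Representant G (3 ∷ w₁ ++ 1 ∷ w₂ ++ 2 ∷ w₃))
corollary12 G (positive , injective) (_ , _ , edge-square) (w , rep) x c 1∈ 2∈ 3∈ x∈ _ _ x≢3 _
            sq1 sq3 sq2 sqx 1~3 3~2 2~x x~1 only-c-at-1 only-c-at-3 =
  Reorder.reorder G positive 1∈ 2∈ 3∈ 1~3 3~2 1≁2 neighbours-of-3 high-neighbours-of-1 w rep
  where
  open LabeledGridGraph G
  open EndSquare G injective edge-square c

  -- 1 and 2 are opposite corners of the square.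
  1≁2 : ¬ Adj G 1 2
  1≁2 = triangle-free sq1 sq3 sq2 1~3 3~2

  -- 3 and 1 lie in no other square, so their neighbours are those on the square.
  neighbours-of-3 : ∀ v → v ∈ V → Adj G 3 v → v ≡ 1 ⊎ v ≡ 2
  neighbours-of-3 = neighbours-of-end-vertex 3∈ 1∈ 2∈ sq3 sq1 sq2 (gridAdj-sym 1~3) 3~2 (λ ()) only-c-at-3

  high-neighbours-of-1 : ∀ v → v ∈ V → 4 ≤ v → Adj G 1 v → Adj G 2 v
  high-neighbours-of-1 v v∈ v≥4 1~v
    with neighbours-of-end-vertex 1∈ 3∈ x∈ sq1 sq3 sqx 1~3 (gridAdj-sym x~1) (x≢3 ∘ sym) only-c-at-1 v v∈ 1~v
  ... | inj₁ refl = ⊥-elim (high≢low v≥4 3<4 refl)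
  ... | inj₂ refl = 2~x
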